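{- Let $A,B$ be disjoint finite sets with $|A|=a$, $|B|=b$. Then \[ (1+t)\sum_{c\ \text{good}}t^{g(c)+w(c)}=\sum_{i=0}^{\min(a,b)}\binom{2i}{i}\binom{a}{i}\binom{b}{i}t^i(1+t)^{a+b+1-2i}=(1+t)\sum_{i=0}^a\sum_{j=0}^b\binom{a}{i}\binom{b}{j}\binom{a-i+j}{j}\binom{b+i-j}{i}t^{i+j}, \] where the first sum runs over all good colorings $c$ of $A\sqcup B$.
   Context: A coloring is a map $c\colon A\sqcup B\to\{R,G,W,B\}$ (red, green, white, black); $g(c)$ and $w(c)$ denote the numbers of green and white elements. A coloring is good if the number of red elements in $A$ equals the number of green elements in $B$ and the number of green elements in $A$ equals the number of red elements in $B$. -}

module Defs where

open import Level using (Level)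
open import Data.Nat using (ℕ; zero; suc; _+_; _∸_; _⊓_)
open import Data.Nat.Combinatorics using (_C_)
open import Data.List using (List; []; _∷_; [_]; map; concatMap; filter; foldr; upTo)
open import Data.Vec using (Vec; []; _∷_)
open import Data.Product using (_×_; _,_; proj₁; proj₂)
open import Relation.Binary.PropositionalEquality using (_≡_)
open import Relation.Nullary using (Dec; yes; no)
open import Relation.Nullary.Decidable using (_×-dec_)
open import Algebra.Bundles using (CommutativeSemiring)
import Algebra.Definitions.RawSemiring as RS
import Data.Nat as ℕ

data Color : Set where
  red green white black : Color

_≟ᶜ_ : (x y : Color) → Dec (x ≡ y)
red ≟ᶜ red = yes _≡_.refl
green ≟ᶜ green = yes _≡_.refl
white ≟ᶜ white = yes _≡_.refl
black ≟ᶜ black = yes _≡_.refl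
red ≟ᶜ green = no λ ()
red ≟ᶜ white = no λ ()
red ≟ᶜ black = no λ ()
green ≟ᶜ red = no λ ()
green ≟ᶜ white = no λ ()
green ≟ᶜ black = no λ ()
white ≟ᶜ red = no λ ()
white ≟ᶜ green = no λ ()
white ≟ᶜ black = no λ ()
black ≟ᶜ red = no λ ()
black ≟ᶜ green = no λ ()
black ≟ᶜ white = no λ ()

count : ∀ {n} → Color → Vec Color n → ℕ
count x [] = 0
count x (y ∷ v) with x ≟ᶜ y
... | yes _ = suc (count x v)
... | no _ = count x v

colors : List Color
colors = red ∷ green ∷ white ∷ black ∷ []

allVecs : (n : ℕ) → List (Vec Color n)
allVecs zero = [ [] ]
allVecs (suc n) = concatMap (λ x → map (x ∷_) (allVecs n)) colors

-- A colouring of A ⊔ B with |A| = a, |B| = b: colours on A and colours on B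
Coloring : ℕ → ℕ → Set
Coloring a b = Vec Color a × Vec Color b

allColorings : (a b : ℕ) → List (Coloring a b)
allColorings a b = concatMap (λ u → map (u ,_) (allVecs b)) (allVecs a)

Good : ∀ {a b} → Coloring a b → Set
Good (u , v) = (count red u ≡ count green v) × (count green u ≡ count red v)

good? : ∀ {a b} (c : Coloring a b) → Dec (Good c)
good? (u , v) = (count red u ℕ.≟ count green v) ×-dec (count green u ℕ.≟ count red v)

goodColorings : (a b : ℕ) → List (Coloring a b)
goodColorings a b = filter good? (allColorings a b)

gC : ∀ {a b} → Coloring a b → ℕ
gC (u , v) = count green u + count green v

wC : ∀ {a b} → Coloring a b → ℕ
wC (u , v) = count white u + count white v

module _ {c ℓ : Level} (R : CommutativeSemiring c ℓ) where
  open CommutativeSemiring R using (Carrier; 0#; 1#; rawSemiring) renaming (_+_ to _⊕_; _*_ to _⊛_)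
  open RS rawSemiring using (_^_) renaming (_×_ to _·_)

  Σ : {X : Set} → List X → (X → Carrier) → Carrier
  Σ xs f = foldr (λ x s → f x ⊕ s) 0# xs

  ⟦_⟧ : ℕ → Carrier
  ⟦ n ⟧ = n · 1#

  lhs : ℕ → ℕ → Carrier → Carrier
  lhs a b t = (1# ⊕ t) ⊛ Σ (goodColorings a b) (λ col → t ^ (gC col + wC col))

  middle : ℕ → ℕ → Carrier → Carrier
  middle a b t = Σ (upTo (suc (a ⊓ b))) λ i →
    ⟦ ((i + i) C i) ℕ.* (a C i) ℕ.* (b C i) ⟧ ⊛ (t ^ i) ⊛ ((1# ⊕ t) ^ (a + b + 1 ∸ (i + i)))

  rhs : ℕ → ℕ → Carrier → Carrier
  rhs a b t = (1# ⊕ t) ⊛ Σ (upTo (suc a)) λ i → Σ (upTo (suc b)) λ j →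
    ⟦ (a C i) ℕ.* (b C j) ℕ.* ((a ∸ i + j) C j) ℕ.* ((b + i ∸ j) C i) ⟧ ⊛ (t ^ (i + j))

-- Sum over the colorings v of B inside the sum over the colorings u of A; goodness
-- prescribes the red and green counts of v to be the green and red counts of u.
-- Middle expression: the colorings of an n-set with r red and g green points, weighted
-- by t^#white, sum to C(n,r+g) C(r+g,r) (1+t)^(n-r-g) (choose the red or green points,
-- then the red ones; every other point is white or black).  So the term of u depends only
-- on k = #red u and l = #green u, and along the antidiagonal k + l = i the factors
-- C(i,k) C(i,l) sum to C(2i,i) by Vandermonde.
-- Right-hand expression: group instead by i = #green u + #white u and j = #green v + #white v.
-- An n-set has C(n,m) C(m,g) C(n-m,r) colorings with r red, g green and m green-or-white
-- points, so for fixed i and j the sums over the red and green counts of u split into the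
-- Vandermonde convolutions Σ_k C(j,k) C(a-i,k) = C(a-i+j,j) and Σ_l C(b-j,l) C(i,l) = C(b-j+i,i).

module Submission where

open import Defs hiding (⟦_⟧)
import Defs
open import Level using (Level)
open import Data.Bool using (Bool; true; false; _∧_)
open import Data.Nat as ℕ using (ℕ; zero; suc; _∸_; _≤_; _<_; z≤n; s≤s; _≡ᵇ_; _⊓_)
import Data.Nat.Properties as ℕ
open import Data.List using (List; []; _∷_; _++_; map; concatMap; filter; upTo)
open import Data.List.Properties using (map-upTo)
open import Data.List.Membership.Propositional using (_∈_)
open import Data.List.Membership.Propositional.Properties using (∈-upTo⁻)
open import Data.List.Relation.Unary.Any using (here; there)
open import Data.Product using (_×_; _,_)
open import Data.Vec using (Vec; []; _∷_)
open import Data.Sum using (_⊎_; inj₁; inj₂)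
open import Data.Nat.Combinatorics using (_C_; nCk+nC[k+1]≡[n+1]C[k+1]; k>n⇒nCk≡0; nCk≡nC[n∸k])
open import Function using (_∘_)
open import Relation.Binary.PropositionalEquality as ≡ using (_≡_)
open import Relation.Nullary using (Dec; does; yes; no)
open import Relation.Unary using (Pred; Decidable)
open import Algebra.Bundles using (CommutativeSemiring)

∸≡suc[∸suc] : ∀ {n j} → j < n → n ∸ j ≡ suc (n ∸ suc j)
∸≡suc[∸suc] {suc n} {zero}  _         = ≡.refl
∸≡suc[∸suc] {suc n} {suc j} (s≤s j<n) = ∸≡suc[∸suc] j<n

∸≡suc[∸suc]⊎C≡0 : ∀ n j → n ∸ j ≡ suc (n ∸ suc j) ⊎ n C suc j ≡ 0
∸≡suc[∸suc]⊎C≡0 n j with j ℕ.<? n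
... | yes j<n = inj₁ (∸≡suc[∸suc] j<n)
... | no  j≮n = inj₂ (k>n⇒nCk≡0 (s≤s (ℕ.≮⇒≥ j≮n)))

1+[b∸i]+[a∸i]≡a+b+1∸[i+i] : ∀ {a b i} → i ≤ a → i ≤ b → suc ((b ∸ i) ℕ.+ (a ∸ i)) ≡ a ℕ.+ b ℕ.+ 1 ∸ (i ℕ.+ i)
1+[b∸i]+[a∸i]≡a+b+1∸[i+i] {a} {b} {zero} _ _ = ≡.trans (≡.cong suc (ℕ.+-comm b a)) (ℕ.+-comm 1 (a ℕ.+ b))
1+[b∸i]+[a∸i]≡a+b+1∸[i+i] {suc a} {suc b} {suc i} (s≤s i≤a) (s≤s i≤b) = ≡.trans (1+[b∸i]+[a∸i]≡a+b+1∸[i+i] i≤a i≤b)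
  (≡.cong₂ _∸_ (≡.cong (ℕ._+ 1) (≡.sym (ℕ.+-suc a b))) (≡.sym (ℕ.+-suc i i)))

m⊓n<o⇒m<o⊎n<o : ∀ {m n o} → m ⊓ n < o → m < o ⊎ n < o
m⊓n<o⇒m<o⊎n<o {m} {n} {o} m⊓n<o with ℕ.⊓-sel m n
... | inj₁ m⊓n≡m = inj₁ (≡.subst (_< o) m⊓n≡m m⊓n<o)
... | inj₂ m⊓n≡n = inj₂ (≡.subst (_< o) m⊓n≡n m⊓n<o)

[m+n]Cn≡[n+m]Cm : ∀ m n → (m ℕ.+ n) C n ≡ (n ℕ.+ m) C m
[m+n]Cn≡[n+m]Cm m n = begin
    (m ℕ.+ n) C n                  ≡⟨ nCk≡nC[n∸k] (ℕ.m≤n+m n m) ⟩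
    (m ℕ.+ n) C (m ℕ.+ n ∸ n)      ≡⟨ ≡.cong ((m ℕ.+ n) C_) (ℕ.m+n∸n≡m m n) ⟩
    (m ℕ.+ n) C m                  ≡⟨ ≡.cong (_C m) (ℕ.+-comm m n) ⟩
    (n ℕ.+ m) C m                  ∎
  where open ≡.≡-Reasoning

module Sums {c ℓ : Level} (R : CommutativeSemiring c ℓ) where

  open CommutativeSemiring R renaming (Carrier to A)
  open import Relation.Binary.Reasoning.Setoid setoid
  open import Algebra.Solver.Ring.NaturalCoefficients.Default R using (solve; _:+_; _:*_; _:=_; con)
  open import Algebra.Properties.Semiring.Mult semiring using (×-homo-+; ×1-homo-*)

  infix 6.5 Σ-syntax Σ<-syntax

  Σ-syntax : {X : Set} → List X → (X → A) → A
  Σ-syntax = Σ R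
  syntax Σ-syntax xs (λ x → f) = ∑[ x ∈ xs ] f

  Σ<-syntax : ℕ → (ℕ → A) → A
  Σ<-syntax N = Σ R (upTo N)
  syntax Σ<-syntax N (λ k → f) = ∑[ k < N ] f

  private
    variable
      X Y : Set

  Σ-cong : (xs : List X) {f g : X → A} → (∀ x → f x ≈ g x) → Σ R xs f ≈ Σ R xs g
  Σ-cong []       f≈g = refl
  Σ-cong (x ∷ xs) f≈g = +-cong (f≈g x) (Σ-cong xs f≈g)

  Σ-cong-∈ : (xs : List X) {f g : X → A} → (∀ {x} → x ∈ xs → f x ≈ g x) → Σ R xs f ≈ Σ R xs g
  Σ-cong-∈ []       f≈g = refl
  Σ-cong-∈ (x ∷ xs) f≈g = +-cong (f≈g (here ≡.refl)) (Σ-cong-∈ xs (f≈g ∘ there))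

  Σ-zero : (xs : List X) {f : X → A} → (∀ x → f x ≈ 0#) → Σ R xs f ≈ 0#
  Σ-zero []       f≈0 = refl
  Σ-zero (x ∷ xs) f≈0 = trans (+-cong (f≈0 x) (Σ-zero xs f≈0)) (+-identityˡ 0#)

  Σ-+ : (xs : List X) (f g : X → A) → Σ R xs (λ x → f x + g x) ≈ Σ R xs f + Σ R xs g
  Σ-+ []       f g = sym (+-identityˡ 0#)
  Σ-+ (x ∷ xs) f g = trans (+-congˡ (Σ-+ xs f g))
    (solve 4 (λ a b c d → (a :+ b) :+ (c :+ d) := (a :+ c) :+ (b :+ d)) refl (f x) (g x) _ _)

  Σ-*ˡ : (xs : List X) (k : A) (f : X → A) → k * Σ R xs f ≈ Σ R xs (λ x → k * f x)
  Σ-*ˡ []       k f = zeroʳ k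
  Σ-*ˡ (x ∷ xs) k f = trans (distribˡ k (f x) _) (+-congˡ (Σ-*ˡ xs k f))

  Σ-*ʳ : (xs : List X) (k : A) (f : X → A) → Σ R xs f * k ≈ Σ R xs (λ x → f x * k)
  Σ-*ʳ xs k f = trans (*-comm _ k) (trans (Σ-*ˡ xs k f) (Σ-cong xs (λ x → *-comm k (f x))))

  Σ-*-Σ : (xs : List X) (ys : List Y) (f : X → A) (g : Y → A) →
          Σ R xs (λ x → Σ R ys (λ y → f x * g y)) ≈ Σ R xs f * Σ R ys g
  Σ-*-Σ xs ys f g = trans (Σ-cong xs (λ x → sym (Σ-*ˡ ys (f x) g))) (sym (Σ-*ʳ xs (Σ R ys g) f))

  Σ-++ : (xs ys : List X) (f : X → A) → Σ R (xs ++ ys) f ≈ Σ R xs f + Σ R ys f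
  Σ-++ []       ys f = sym (+-identityˡ _)
  Σ-++ (x ∷ xs) ys f = trans (+-congˡ (Σ-++ xs ys f)) (sym (+-assoc _ _ _))

  Σ-swap : (xs : List X) (ys : List Y) (f : X → Y → A) →
           Σ R xs (λ x → Σ R ys (f x)) ≈ Σ R ys (λ y → Σ R xs (λ x → f x y))
  Σ-swap []       ys f = sym (Σ-zero ys (λ _ → refl))
  Σ-swap (x ∷ xs) ys f = trans (+-congˡ (Σ-swap xs ys f)) (sym (Σ-+ ys (f x) _))

  Σ-map : (h : X → Y) (xs : List X) (f : Y → A) → Σ R (map h xs) f ≡ Σ R xs (f ∘ h)
  Σ-map h []       f = ≡.refl
  Σ-map h (x ∷ xs) f = ≡.cong (f (h x) +_) (Σ-map h xs f)

  Σ-concatMap : (h : X → List Y) (xs : List X) (f : Y → A) →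
                Σ R (concatMap h xs) f ≈ Σ R xs (λ x → Σ R (h x) f)
  Σ-concatMap h []       f = refl
  Σ-concatMap h (x ∷ xs) f = trans (Σ-++ (h x) (concatMap h xs) f) (+-congˡ (Σ-concatMap h xs f))

  𝟙 : Bool → A
  𝟙 true  = 1#
  𝟙 false = 0#

  𝟙-∧ : ∀ p q → 𝟙 (p ∧ q) ≈ 𝟙 p * 𝟙 q
  𝟙-∧ true  q = sym (*-identityˡ _)
  𝟙-∧ false q = sym (zeroˡ _)

  Σ-filter : {p : Level} {P : Pred X p} (P? : Decidable P) (xs : List X) (f : X → A) →
             Σ R (filter P? xs) f ≈ Σ R xs (λ x → 𝟙 (does (P? x)) * f x)
  Σ-filter P? []       f = refl
  Σ-filter P? (x ∷ xs) f with does (P? x)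
  ... | true  = +-cong (sym (*-identityˡ _)) (Σ-filter P? xs f)
  ... | false = trans (Σ-filter P? xs f) (trans (sym (+-identityˡ _)) (+-congʳ (sym (zeroˡ _))))

  δ : ℕ → ℕ → A
  δ m n = 𝟙 (m ≡ᵇ n)

  δ-subst : ∀ m n (f : ℕ → A) → δ m n * f n ≈ δ m n * f m
  δ-subst zero    zero    f = refl
  δ-subst zero    (suc n) f = trans (zeroˡ _) (sym (zeroˡ _))
  δ-subst (suc m) zero    f = trans (zeroˡ _) (sym (zeroˡ _))
  δ-subst (suc m) (suc n) f = δ-subst m n (f ∘ suc)

  ∑<-suc : ∀ N (f : ℕ → A) → ∑[ k < suc N ] f k ≡ f 0 + ∑[ k < N ] f (suc k)
  ∑<-suc N f = ≡.cong (f 0 +_)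
    (≡.trans (≡.cong (λ ks → Σ R ks f) (≡.sym (map-upTo suc N))) (Σ-map suc (upTo N) f))

  ∑<-cong : ∀ N {f g : ℕ → A} → (∀ k → k < N → f k ≈ g k) → ∑[ k < N ] f k ≈ ∑[ k < N ] g k
  ∑<-cong N f≈g = Σ-cong-∈ (upTo N) (λ k∈ → f≈g _ (∈-upTo⁻ k∈))

  ∑<-select : ∀ {N x} (f : ℕ → A) → x < N → ∑[ k < N ] δ k x * f k ≈ f x
  ∑<-select {suc N} {zero} f _ = begin
      ∑[ k < suc N ] δ k 0 * f k                 ≡⟨ ∑<-suc N _ ⟩
      1# * f 0 + ∑[ k < N ] 0# * f (suc k)       ≈⟨ +-cong (*-identityˡ _) (Σ-zero (upTo N) (λ _ → zeroˡ _)) ⟩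
      f 0 + 0#                                   ≈⟨ +-identityʳ _ ⟩
      f 0                                        ∎
  ∑<-select {suc N} {suc x} f (s≤s x<N) = begin
      ∑[ k < suc N ] δ k (suc x) * f k           ≡⟨ ∑<-suc N _ ⟩
      0# * f 0 + ∑[ k < N ] δ k x * f (suc k)    ≈⟨ +-cong (zeroˡ _) (∑<-select (f ∘ suc) x<N) ⟩
      0# + f (suc x)                             ≈⟨ +-identityˡ _ ⟩
      f (suc x)                                  ∎

  ∑<-truncate : ∀ {M N} {f : ℕ → A} → M ≤ N → (∀ k → M ≤ k → f k ≈ 0#) → ∑[ k < N ] f k ≈ ∑[ k < M ] f k
  ∑<-truncate {zero} {N} _ f≈0 = Σ-zero (upTo N) (λ k → f≈0 k z≤n)
  ∑<-truncate {suc M} {suc N} {f} (s≤s M≤N) f≈0 = begin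
      ∑[ k < suc N ] f k            ≡⟨ ∑<-suc N f ⟩
      f 0 + ∑[ k < N ] f (suc k)    ≈⟨ +-congˡ (∑<-truncate M≤N (λ k M≤k → f≈0 (suc k) (s≤s M≤k))) ⟩
      f 0 + ∑[ k < M ] f (suc k)    ≡⟨ ≡.sym (∑<-suc M f) ⟩
      ∑[ k < suc M ] f k            ∎

  ∑<-triangle : ∀ N (F : ℕ → ℕ → A) →
                ∑[ k < N ] ∑[ l < N ∸ k ] F k l ≈ ∑[ i < N ] ∑[ k < suc i ] F k (i ∸ k)
  ∑<-triangle zero    F = refl
  ∑<-triangle (suc N) F = begin
      ∑[ k < suc N ] ∑[ l < suc N ∸ k ] F k l
    ≡⟨ ∑<-suc N _ ⟩
      ∑[ l < suc N ] F 0 l + ∑[ k < N ] ∑[ l < N ∸ k ] F (suc k) l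
    ≈⟨ +-congˡ (∑<-triangle N (F ∘ suc)) ⟩
      ∑[ l < suc N ] F 0 l + ∑[ i < N ] G i
    ≡⟨ ≡.cong (_+ ∑[ i < N ] G i) (∑<-suc N (F 0)) ⟩
      (F 0 0 + ∑[ i < N ] F 0 (suc i)) + ∑[ i < N ] G i
    ≈⟨ +-assoc _ _ _ ⟩
      F 0 0 + (∑[ i < N ] F 0 (suc i) + ∑[ i < N ] G i)
    ≈⟨ +-cong (sym (+-identityʳ _)) (sym (Σ-+ (upTo N) _ G)) ⟩
      (F 0 0 + 0#) + ∑[ i < N ] (F 0 (suc i) + G i)
    ≈⟨ +-congˡ (Σ-cong (upTo N) (λ i → reflexive (≡.sym (∑<-suc (suc i) (λ k → F k (suc i ∸ k)))))) ⟩
      (F 0 0 + 0#) + ∑[ i < N ] ∑[ k < suc (suc i) ] F k (suc i ∸ k)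
    ≡⟨ ≡.sym (∑<-suc N (λ i → ∑[ k < suc i ] F k (i ∸ k))) ⟩
      ∑[ i < suc N ] ∑[ k < suc i ] F k (i ∸ k)
    ∎
    where
    G : ℕ → A
    G i = ∑[ k < suc i ] F (suc k) (i ∸ k)

  Σ-fibres : ∀ {N : ℕ} (xs : List X) (s : X → ℕ) (F : ℕ → X → A) → (∀ x → s x < N) →
             ∑[ x ∈ xs ] F (s x) x ≈ ∑[ k < N ] ∑[ x ∈ xs ] δ k (s x) * F k x
  Σ-fibres {N = N} xs s F s<N = trans (Σ-cong xs (λ x → sym (∑<-select (λ k → F k x) (s<N x))))
                                  (Σ-swap xs (upTo N) (λ x k → δ k (s x) * F k x))

  shift : (ℕ → A) → ℕ → A
  shift f zero    = 0#
  shift f (suc k) = f k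

  shift-cong : ∀ {f g : ℕ → A} → (∀ k → f k ≈ g k) → ∀ k → shift f k ≈ shift g k
  shift-cong f≈g zero    = refl
  shift-cong f≈g (suc k) = f≈g k

  shift-*ˡ : ∀ x (f : ℕ → A) k → x * shift f k ≈ shift (λ k → x * f k) k
  shift-*ˡ x f zero    = zeroʳ x
  shift-*ˡ x f (suc k) = refl

  shift-*ʳ : ∀ x (f : ℕ → A) k → shift f k * x ≈ shift (λ k → f k * x) k
  shift-*ʳ x f zero    = zeroˡ x
  shift-*ʳ x f (suc k) = refl

module Binomials {c ℓ : Level} (R : CommutativeSemiring c ℓ) where

  open CommutativeSemiring R renaming (Carrier to A)
  open Sums R
  open import Relation.Binary.Reasoning.Setoid setoid
  open import Algebra.Properties.Semiring.Mult semiring using (×-homo-+; ×1-homo-*)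

  ⟦_⟧ : ℕ → A
  ⟦ n ⟧ = Defs.⟦_⟧ R n

  ⟦+⟧ : ∀ m n → ⟦ m ℕ.+ n ⟧ ≈ ⟦ m ⟧ + ⟦ n ⟧
  ⟦+⟧ = ×-homo-+ 1#

  ⟦*⟧ : ∀ m n → ⟦ m ℕ.* n ⟧ ≈ ⟦ m ⟧ * ⟦ n ⟧
  ⟦*⟧ = ×1-homo-*

  ⟦1⟧ : ⟦ 1 ⟧ ≈ 1#
  ⟦1⟧ = +-identityʳ 1#

  ⟦C-suc⟧ : ∀ n k → ⟦ suc n C k ⟧ ≈ shift (λ k → ⟦ n C k ⟧) k + ⟦ n C k ⟧
  ⟦C-suc⟧ n zero    = sym (+-identityˡ _)
  ⟦C-suc⟧ n (suc k) = trans (reflexive (≡.cong ⟦_⟧ (≡.sym (nCk+nC[k+1]≡[n+1]C[k+1] n k)))) (⟦+⟧ (n C k) (n C suc k))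

  vandermonde : ∀ p q d {N} → q < N → ∑[ k < N ] ⟦ p C (d ℕ.+ k) ⟧ * ⟦ q C k ⟧ ≈ ⟦ (p ℕ.+ q) C (d ℕ.+ q) ⟧
  vandermonde p zero d {suc N} _ = begin
      ∑[ k < suc N ] ⟦ p C (d ℕ.+ k) ⟧ * ⟦ 0 C k ⟧
    ≡⟨ ∑<-suc N _ ⟩
      ⟦ p C (d ℕ.+ 0) ⟧ * ⟦ 1 ⟧ + ∑[ k < N ] ⟦ p C (d ℕ.+ suc k) ⟧ * 0#
    ≈⟨ +-cong (trans (*-congˡ ⟦1⟧) (*-identityʳ _)) (Σ-zero (upTo N) (λ _ → zeroʳ _)) ⟩
      ⟦ p C (d ℕ.+ 0) ⟧ + 0#
    ≈⟨ +-identityʳ _ ⟩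
      ⟦ p C (d ℕ.+ 0) ⟧
    ≡⟨ ≡.cong (λ n → ⟦ n C (d ℕ.+ 0) ⟧) (≡.sym (ℕ.+-identityʳ p)) ⟩
      ⟦ (p ℕ.+ 0) C (d ℕ.+ 0) ⟧
    ∎
  vandermonde p (suc q) d {suc N} (s≤s q<N) = begin
      ∑[ k < suc N ] ⟦ p C (d ℕ.+ k) ⟧ * ⟦ suc q C k ⟧
    ≈⟨ Σ-cong (upTo (suc N)) (λ k → trans (*-congˡ (⟦C-suc⟧ q k)) (distribˡ _ _ _)) ⟩
      ∑[ k < suc N ] (⟦ p C (d ℕ.+ k) ⟧ * shift (λ k → ⟦ q C k ⟧) k + ⟦ p C (d ℕ.+ k) ⟧ * ⟦ q C k ⟧)
    ≈⟨ Σ-+ (upTo (suc N)) _ _ ⟩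
      ∑[ k < suc N ] ⟦ p C (d ℕ.+ k) ⟧ * shift (λ k → ⟦ q C k ⟧) k + ∑[ k < suc N ] ⟦ p C (d ℕ.+ k) ⟧ * ⟦ q C k ⟧
    ≈⟨ +-cong (reflexive (∑<-suc N _)) (vandermonde p q d (ℕ.m<n⇒m<1+n q<N)) ⟩
      (⟦ p C (d ℕ.+ 0) ⟧ * 0# + ∑[ k < N ] ⟦ p C (d ℕ.+ suc k) ⟧ * ⟦ q C k ⟧) + ⟦ (p ℕ.+ q) C (d ℕ.+ q) ⟧
    ≈⟨ +-congʳ (trans (+-cong (zeroʳ _) (Σ-cong (upTo N) (λ k → reflexive (≡.cong (λ i → ⟦ p C i ⟧ * ⟦ q C k ⟧) (ℕ.+-suc d k)))))
                      (+-identityˡ _)) ⟩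
      ∑[ k < N ] ⟦ p C (suc d ℕ.+ k) ⟧ * ⟦ q C k ⟧ + ⟦ (p ℕ.+ q) C (d ℕ.+ q) ⟧
    ≈⟨ +-congʳ (vandermonde p q (suc d) q<N) ⟩
      ⟦ (p ℕ.+ q) C suc (d ℕ.+ q) ⟧ + ⟦ (p ℕ.+ q) C (d ℕ.+ q) ⟧
    ≈⟨ +-comm _ _ ⟩
      ⟦ (p ℕ.+ q) C (d ℕ.+ q) ⟧ + ⟦ (p ℕ.+ q) C suc (d ℕ.+ q) ⟧
    ≈⟨ sym (⟦C-suc⟧ (p ℕ.+ q) (suc (d ℕ.+ q))) ⟩
      ⟦ suc (p ℕ.+ q) C suc (d ℕ.+ q) ⟧
    ≡⟨ ≡.sym (≡.cong₂ (λ m n → ⟦ m C n ⟧) (ℕ.+-suc p q) (ℕ.+-suc d q)) ⟩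
      ⟦ (p ℕ.+ suc q) C (d ℕ.+ suc q) ⟧
    ∎

module Colorings {c ℓ : Level} (R : CommutativeSemiring c ℓ) (t : CommutativeSemiring.Carrier R) where

  open CommutativeSemiring R renaming (Carrier to A)
  open Sums R
  open Binomials R
  open import Relation.Binary.Reasoning.Setoid setoid
  open import Algebra.Solver.Ring.NaturalCoefficients.Default R using (solve; _:+_; _:*_; _:=_; con)
  open import Algebra.Definitions.RawSemiring rawSemiring using (_^_)
  open import Algebra.Properties.Semiring.Exp semiring using (^-homo-*)
  open import Algebra.Properties.CommutativeSemigroup ℕ.+-commutativeSemigroup using () renaming (interchange to +-interchange)

  reds greens whites : ∀ {n} → Vec Color n → ℕ
  reds   = count red
  greens = count green
  whites = count white

  count≤length : ∀ {n} x (v : Vec Color n) → count x v ≤ n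
  count≤length x []      = z≤n
  count≤length x (y ∷ v) with x ≟ᶜ y
  ... | yes _ = s≤s (count≤length x v)
  ... | no  _ = ℕ.m≤n⇒m≤1+n (count≤length x v)

  greens+whites≤length : ∀ {n} (v : Vec Color n) → greens v ℕ.+ whites v ≤ n
  greens+whites≤length []          = z≤n
  greens+whites≤length (red ∷ v)   = ℕ.m≤n⇒m≤1+n (greens+whites≤length v)
  greens+whites≤length (green ∷ v) = s≤s (greens+whites≤length v)
  greens+whites≤length (white ∷ v) = ℕ.≤-trans (ℕ.≤-reflexive (ℕ.+-suc (greens v) (whites v))) (s≤s (greens+whites≤length v))
  greens+whites≤length (black ∷ v) = ℕ.m≤n⇒m≤1+n (greens+whites≤length v)

  Σ-allVecs-suc : ∀ n (f : Vec Color (suc n) → A) →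
                  ∑[ v ∈ allVecs (suc n) ] f v ≈ ∑[ x ∈ colors ] ∑[ v ∈ allVecs n ] f (x ∷ v)
  Σ-allVecs-suc n f = trans (Σ-concatMap (λ x → map (x ∷_) (allVecs n)) colors f)
                            (Σ-cong colors (λ x → reflexive (Σ-map (x ∷_) (allVecs n) f)))

  1+t : A
  1+t = 1# + t

  redGreenPoly : ℕ → ℕ → ℕ → A
  redGreenPoly n r g = ∑[ v ∈ allVecs n ] δ r (reds v) * (δ g (greens v) * t ^ whites v)

  redGreenPoly-suc : ∀ n r g → redGreenPoly (suc n) r g ≈
    shift (λ r → redGreenPoly n r g) r + (shift (redGreenPoly n r) g + 1+t * redGreenPoly n r g)
  redGreenPoly-suc n r g = begin
      redGreenPoly (suc n) r g
    ≈⟨ Σ-allVecs-suc n _ ⟩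
      Red r + (Green g + (White + (redGreenPoly n r g + 0#)))
    ≈⟨ +-cong (red-term r) (+-cong (green-term g) (+-congˡ (+-identityʳ _))) ⟩
      shift (λ r → redGreenPoly n r g) r + (shift (redGreenPoly n r) g + (White + redGreenPoly n r g))
    ≈⟨ +-congˡ (+-congˡ white+black) ⟩
      shift (λ r → redGreenPoly n r g) r + (shift (redGreenPoly n r) g + 1+t * redGreenPoly n r g)
    ∎
    where
    Red : ℕ → A
    Red r = ∑[ v ∈ allVecs n ] δ r (suc (reds v)) * (δ g (greens v) * t ^ whites v)
    Green : ℕ → A
    Green g = ∑[ v ∈ allVecs n ] δ r (reds v) * (δ g (suc (greens v)) * t ^ whites v)
    White : A
    White = ∑[ v ∈ allVecs n ] δ r (reds v) * (δ g (greens v) * (t * t ^ whites v))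
    red-term : ∀ r → Red r ≈ shift (λ r → redGreenPoly n r g) r
    red-term zero    = Σ-zero (allVecs n) (λ _ → zeroˡ _)
    red-term (suc r) = refl
    green-term : ∀ g → Green g ≈ shift (redGreenPoly n r) g
    green-term zero    = Σ-zero (allVecs n) (λ _ → trans (*-congˡ (zeroˡ _)) (zeroʳ _))
    green-term (suc g) = refl
    white+black : White + redGreenPoly n r g ≈ 1+t * redGreenPoly n r g
    white+black = begin
        White + redGreenPoly n r g
      ≈⟨ +-congʳ (Σ-cong (allVecs n) (λ v →
           solve 4 (λ x y t w → x :* (y :* (t :* w)) := t :* (x :* (y :* w))) refl (δ r (reds v)) (δ g (greens v)) t _)) ⟩
        ∑[ v ∈ allVecs n ] t * (δ r (reds v) * (δ g (greens v) * t ^ whites v)) + redGreenPoly n r g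
      ≈⟨ +-congʳ (sym (Σ-*ˡ (allVecs n) t _)) ⟩
        t * redGreenPoly n r g + redGreenPoly n r g
      ≈⟨ solve 2 (λ t y → t :* y :+ y := (con 1 :+ t) :* y) refl t _ ⟩
        1+t * redGreenPoly n r g
      ∎

  redGreenClosed : ℕ → ℕ → ℕ → A
  redGreenClosed n i r = ⟦ n C i ⟧ * ⟦ i C r ⟧ * 1+t ^ (n ∸ i)

  ⟦C⟧*1+t^∸ : ∀ n j y → ⟦ n C suc j ⟧ * y * 1+t ^ (n ∸ j) ≈ 1+t * (⟦ n C suc j ⟧ * y * 1+t ^ (n ∸ suc j))
  ⟦C⟧*1+t^∸ n j y with ∸≡suc[∸suc]⊎C≡0 n j
  ... | inj₁ n∸j≡suc = trans (*-congˡ (reflexive (≡.cong (1+t ^_) n∸j≡suc)))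
    (solve 3 (λ x p q → x :* (p :* q) := p :* (x :* q)) refl (⟦ n C suc j ⟧ * y) 1+t _)
  ... | inj₂ C≡0 rewrite C≡0 = trans (zero-product _) (sym (trans (*-congˡ (zero-product _)) (zeroʳ 1+t)))
    where
    zero-product : ∀ z → 0# * y * z ≈ 0#
    zero-product z = trans (*-congʳ (zeroˡ y)) (zeroˡ z)

  redGreenClosed-zero : ∀ n r → redGreenClosed (suc n) 0 r ≈ 1+t * redGreenClosed n 0 r
  redGreenClosed-zero n r = solve 3 (λ x p q → x :* (p :* q) := p :* (x :* q)) refl (⟦ 1 ⟧ * ⟦ 0 C r ⟧) 1+t _

  redGreenClosed-suc : ∀ n j r → redGreenClosed (suc n) (suc j) r ≈
    shift (redGreenClosed n j) r + (redGreenClosed n j r + 1+t * redGreenClosed n (suc j) r)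
  redGreenClosed-suc n j r = begin
      ⟦ suc n C suc j ⟧ * ⟦ suc j C r ⟧ * Q
    ≈⟨ *-congʳ (*-cong (⟦C-suc⟧ n (suc j)) (⟦C-suc⟧ j r)) ⟩
      (x + y) * (u + v) * Q
    ≈⟨ solve 5 (λ x y u v Q → (x :+ y) :* (u :+ v) :* Q := x :* u :* Q :+ (x :* v :* Q :+ y :* (u :+ v) :* Q)) refl x y u v Q ⟩
      x * u * Q + (x * v * Q + y * (u + v) * Q)
    ≈⟨ +-cong (trans (*-congʳ (shift-*ˡ x _ r)) (shift-*ʳ Q _ r))
              (+-congˡ (trans (*-congʳ (*-congˡ (sym (⟦C-suc⟧ j r)))) (⟦C⟧*1+t^∸ n j _))) ⟩
      shift (redGreenClosed n j) r + (redGreenClosed n j r + 1+t * redGreenClosed n (suc j) r)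
    ∎
    where
    x y u v Q : A
    x = ⟦ n C j ⟧
    y = ⟦ n C suc j ⟧
    u = shift (λ r → ⟦ j C r ⟧) r
    v = ⟦ j C r ⟧
    Q = 1+t ^ (n ∸ j)

  redGreenPoly≈ : ∀ n r g {i} → r ℕ.+ g ≡ i → redGreenPoly n r g ≈ redGreenClosed n i r
  redGreenPoly≈ zero zero    zero    ≡.refl =
    trans (+-identityʳ _) (trans (*-identityˡ _) (trans (*-identityˡ _)
      (sym (trans (*-identityʳ _) (trans (*-cong ⟦1⟧ ⟦1⟧) (*-identityˡ 1#))))))
  redGreenPoly≈ zero zero    (suc g) ≡.refl =
    trans (+-identityʳ _) (trans (*-identityˡ _) (trans (zeroˡ _) (sym (trans (*-congʳ (zeroˡ _)) (zeroˡ _)))))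
  redGreenPoly≈ zero (suc r) g       ≡.refl =
    trans (+-identityʳ _) (trans (zeroˡ _) (sym (trans (*-congʳ (zeroˡ _)) (zeroˡ _))))
  redGreenPoly≈ (suc n) zero zero ≡.refl = begin
      redGreenPoly (suc n) 0 0
    ≈⟨ redGreenPoly-suc n 0 0 ⟩
      0# + (0# + 1+t * redGreenPoly n 0 0)
    ≈⟨ trans (+-identityˡ _) (+-identityˡ _) ⟩
      1+t * redGreenPoly n 0 0
    ≈⟨ *-congˡ (redGreenPoly≈ n 0 0 ≡.refl) ⟩
      1+t * redGreenClosed n 0 0
    ≈⟨ sym (redGreenClosed-zero n 0) ⟩
      redGreenClosed (suc n) 0 0
    ∎
  redGreenPoly≈ (suc n) r g {suc j} r+g≡1+j = begin
      redGreenPoly (suc n) r g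
    ≈⟨ redGreenPoly-suc n r g ⟩
      shift (λ r → redGreenPoly n r g) r + (shift (redGreenPoly n r) g + 1+t * redGreenPoly n r g)
    ≈⟨ +-cong (red-term r r+g≡1+j) (+-cong (green-term g r+g≡1+j) (*-congˡ (redGreenPoly≈ n r g r+g≡1+j))) ⟩
      shift (redGreenClosed n j) r + (redGreenClosed n j r + 1+t * redGreenClosed n (suc j) r)
    ≈⟨ sym (redGreenClosed-suc n j r) ⟩
      redGreenClosed (suc n) (suc j) r
    ∎
    where
    red-term : ∀ r → r ℕ.+ g ≡ suc j → shift (λ r → redGreenPoly n r g) r ≈ shift (redGreenClosed n j) r
    red-term zero    _ = refl
    red-term (suc r) e = redGreenPoly≈ n r g (ℕ.suc-injective e)
    green-term : ∀ g → r ℕ.+ g ≡ suc j → shift (redGreenPoly n r) g ≈ redGreenClosed n j r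
    green-term zero    e = sym (trans (*-congʳ (trans (*-congˡ (reflexive (≡.cong ⟦_⟧ (k>n⇒nCk≡0 j<r)))) (zeroʳ _))) (zeroˡ _))
      where
      j<r : j < r
      j<r = ℕ.≤-reflexive (≡.sym (≡.trans (≡.sym (ℕ.+-identityʳ r)) e))
    green-term (suc g) e = redGreenPoly≈ n r g (ℕ.suc-injective (≡.trans (≡.sym (ℕ.+-suc r g)) e))

  profileCount : ℕ → ℕ → ℕ → ℕ → A
  profileCount n r g m = ∑[ v ∈ allVecs n ] δ r (reds v) * (δ g (greens v) * δ m (greens v ℕ.+ whites v))

  profileCount-suc : ∀ n r g m → profileCount (suc n) r g m ≈
    shift (λ r → profileCount n r g m) r
      + (shift (λ m → shift (λ g → profileCount n r g m) g) m + (shift (profileCount n r g) m + profileCount n r g m))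
  profileCount-suc n r g m = trans (Σ-allVecs-suc n _)
    (+-cong (red-term r) (+-cong (green-term m g) (+-cong (white-term m) (+-identityʳ _))))
    where
    red-term : ∀ r → ∑[ v ∈ allVecs n ] δ r (suc (reds v)) * (δ g (greens v) * δ m (greens v ℕ.+ whites v))
                     ≈ shift (λ r → profileCount n r g m) r
    red-term zero    = Σ-zero (allVecs n) (λ _ → zeroˡ _)
    red-term (suc r) = refl
    green-term : ∀ m g → ∑[ v ∈ allVecs n ] δ r (reds v) * (δ g (suc (greens v)) * δ m (suc (greens v ℕ.+ whites v)))
                         ≈ shift (λ m → shift (λ g → profileCount n r g m) g) m
    green-term zero    g       = Σ-zero (allVecs n) (λ _ → trans (*-congˡ (zeroʳ _)) (zeroʳ _))
    green-term (suc m) zero    = Σ-zero (allVecs n) (λ _ → trans (*-congˡ (zeroˡ _)) (zeroʳ _))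
    green-term (suc m) (suc g) = refl
    white-term : ∀ m → ∑[ v ∈ allVecs n ] δ r (reds v) * (δ g (greens v) * δ m (greens v ℕ.+ suc (whites v)))
                       ≈ shift (profileCount n r g) m
    white-term m = trans (Σ-cong (allVecs n) (λ v → reflexive (≡.cong (λ k → δ r (reds v) * (δ g (greens v) * δ m k))
                                                                         (ℕ.+-suc (greens v) (whites v)))))
                         (shifted m)
      where
      shifted : ∀ m → ∑[ v ∈ allVecs n ] δ r (reds v) * (δ g (greens v) * δ m (suc (greens v ℕ.+ whites v)))
                      ≈ shift (profileCount n r g) m
      shifted zero    = Σ-zero (allVecs n) (λ _ → trans (*-congˡ (zeroʳ _)) (zeroʳ _))
      shifted (suc m) = refl

  trinomial : ℕ → ℕ → ℕ → ℕ → A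
  trinomial n r g m = ⟦ n C m ⟧ * ⟦ m C g ⟧ * ⟦ (n ∸ m) C r ⟧

  ⟦C⟧*⟦∸C⟧ : ∀ n m r z → ⟦ n C suc m ⟧ * z * ⟦ (n ∸ m) C r ⟧ ≈
    shift (λ r → ⟦ n C suc m ⟧ * z * ⟦ (n ∸ suc m) C r ⟧) r + ⟦ n C suc m ⟧ * z * ⟦ (n ∸ suc m) C r ⟧
  ⟦C⟧*⟦∸C⟧ n m r z with ∸≡suc[∸suc]⊎C≡0 n m
  ... | inj₁ n∸m≡suc = begin
      y * z * ⟦ (n ∸ m) C r ⟧
    ≈⟨ *-congˡ (reflexive (≡.cong (λ k → ⟦ k C r ⟧) n∸m≡suc)) ⟩
      y * z * ⟦ suc (n ∸ suc m) C r ⟧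
    ≈⟨ trans (*-congˡ (⟦C-suc⟧ (n ∸ suc m) r)) (distribˡ _ _ _) ⟩
      y * z * shift (λ r → ⟦ (n ∸ suc m) C r ⟧) r + y * z * ⟦ (n ∸ suc m) C r ⟧
    ≈⟨ +-congʳ (shift-*ˡ (y * z) _ r) ⟩
      shift (λ r → y * z * ⟦ (n ∸ suc m) C r ⟧) r + y * z * ⟦ (n ∸ suc m) C r ⟧
    ∎
    where
    y : A
    y = ⟦ n C suc m ⟧
  ... | inj₂ C≡0 rewrite C≡0 =
    trans (zero-product _) (sym (trans (+-cong (shifted-zero r) (zero-product _)) (+-identityˡ 0#)))
    where
    zero-product : ∀ w → 0# * z * w ≈ 0#
    zero-product w = trans (*-congʳ (zeroˡ z)) (zeroˡ w)
    shifted-zero : ∀ r → shift (λ r → 0# * z * ⟦ (n ∸ suc m) C r ⟧) r ≈ 0#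
    shifted-zero zero    = refl
    shifted-zero (suc r) = zero-product _

  trinomial-suc : ∀ n r g m → trinomial (suc n) r g m ≈
    shift (λ r → trinomial n r g m) r
      + (shift (λ m → shift (λ g → trinomial n r g m) g) m + (shift (trinomial n r g) m + trinomial n r g m))
  trinomial-suc n r g zero = begin
      x * ⟦ suc n C r ⟧
    ≈⟨ trans (*-congˡ (⟦C-suc⟧ n r)) (distribˡ _ _ _) ⟩
      x * shift (λ r → ⟦ n C r ⟧) r + x * ⟦ n C r ⟧
    ≈⟨ +-cong (shift-*ˡ x _ r) (sym (trans (+-identityˡ _) (+-identityˡ _))) ⟩
      shift (λ r → x * ⟦ n C r ⟧) r + (0# + (0# + x * ⟦ n C r ⟧))
    ∎
    where
    x : A
    x = ⟦ 1 ⟧ * ⟦ 0 C g ⟧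
  trinomial-suc n r g (suc m) = begin
      ⟦ suc n C suc m ⟧ * ⟦ suc m C g ⟧ * D
    ≈⟨ *-congʳ (*-cong (⟦C-suc⟧ n (suc m)) (⟦C-suc⟧ m g)) ⟩
      (x + y) * (u + v) * D
    ≈⟨ solve 5 (λ x y u v D → (x :+ y) :* (u :+ v) :* D := y :* (u :+ v) :* D :+ (x :* u :* D :+ x :* v :* D)) refl x y u v D ⟩
      y * (u + v) * D + (x * u * D + x * v * D)
    ≈⟨ +-cong (trans (*-congʳ (*-congˡ (sym (⟦C-suc⟧ m g)))) (⟦C⟧*⟦∸C⟧ n m r _))
              (+-congʳ (trans (*-congʳ (shift-*ˡ x _ g)) (shift-*ʳ D _ g))) ⟩
      (Red + Black) + (shift (λ g → x * ⟦ m C g ⟧ * D) g + x * v * D)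
    ≈⟨ solve 4 (λ R B G W → (R :+ B) :+ (G :+ W) := R :+ (G :+ (W :+ B))) refl Red Black _ _ ⟩
      Red + (shift (λ g → x * ⟦ m C g ⟧ * D) g + (x * v * D + Black))
    ∎
    where
    x y u v D Red Black : A
    x = ⟦ n C m ⟧
    y = ⟦ n C suc m ⟧
    u = shift (λ g → ⟦ m C g ⟧) g
    v = ⟦ m C g ⟧
    D = ⟦ (n ∸ m) C r ⟧
    Red = shift (λ r → trinomial n r g (suc m)) r
    Black = trinomial n r g (suc m)

  profileCount≈ : ∀ n r g m → profileCount n r g m ≈ trinomial n r g m
  profileCount≈ zero zero    zero    zero    = trans (+-identityʳ _) (trans (*-identityˡ _) (trans (*-identityˡ _)
    (sym (trans (*-cong (trans (*-cong ⟦1⟧ ⟦1⟧) (*-identityˡ 1#)) ⟦1⟧) (*-identityˡ 1#)))))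
  profileCount≈ zero r       g       (suc m) = trans (+-identityʳ _) (trans (*-congˡ (zeroʳ _)) (trans (zeroʳ _)
    (sym (trans (*-congʳ (zeroˡ _)) (zeroˡ _)))))
  profileCount≈ zero r       (suc g) zero    = trans (+-identityʳ _) (trans (*-congˡ (zeroˡ _)) (trans (zeroʳ _)
    (sym (trans (*-congʳ (zeroʳ _)) (zeroˡ _)))))
  profileCount≈ zero (suc r) zero    zero    = trans (+-identityʳ _) (trans (zeroˡ _) (sym (zeroʳ _)))
  profileCount≈ (suc n) r g m = begin
      profileCount (suc n) r g m
    ≈⟨ profileCount-suc n r g m ⟩
      shift (λ r → profileCount n r g m) r
        + (shift (λ m → shift (λ g → profileCount n r g m) g) m + (shift (profileCount n r g) m + profileCount n r g m))
    ≈⟨ +-cong (shift-cong (λ r → profileCount≈ n r g m) r)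
              (+-cong (shift-cong (λ m → shift-cong (λ g → profileCount≈ n r g m) g) m)
                      (+-cong (shift-cong (profileCount≈ n r g) m) (profileCount≈ n r g m))) ⟩
      shift (λ r → trinomial n r g m) r
        + (shift (λ m → shift (λ g → trinomial n r g m) g) m + (shift (trinomial n r g) m + trinomial n r g m))
    ≈⟨ sym (trinomial-suc n r g m) ⟩
      trinomial (suc n) r g m
    ∎

  Σ-goodColorings : ∀ a b (f : Coloring a b → A) → ∑[ col ∈ goodColorings a b ] f col ≈
    ∑[ u ∈ allVecs a ] ∑[ v ∈ allVecs b ] δ (reds u) (greens v) * (δ (greens u) (reds v) * f (u , v))
  Σ-goodColorings a b f = begin
      ∑[ col ∈ goodColorings a b ] f col
    ≈⟨ Σ-filter good? (allColorings a b) f ⟩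
      ∑[ col ∈ allColorings a b ] 𝟙 (does (good? col)) * f col
    ≈⟨ Σ-concatMap (λ u → map (u ,_) (allVecs b)) (allVecs a) _ ⟩
      ∑[ u ∈ allVecs a ] ∑[ col ∈ map (u ,_) (allVecs b) ] 𝟙 (does (good? col)) * f col
    ≈⟨ Σ-cong (allVecs a) (λ u → reflexive (Σ-map (u ,_) (allVecs b) _)) ⟩
      ∑[ u ∈ allVecs a ] ∑[ v ∈ allVecs b ] 𝟙 (does (good? (u , v))) * f (u , v)
    ≈⟨ Σ-cong (allVecs a) (λ u → Σ-cong (allVecs b) (λ v →
         trans (*-congʳ (𝟙-∧ (reds u ≡ᵇ greens v) (greens u ≡ᵇ reds v))) (*-assoc _ _ _))) ⟩
      ∑[ u ∈ allVecs a ] ∑[ v ∈ allVecs b ] δ (reds u) (greens v) * (δ (greens u) (reds v) * f (u , v))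
    ∎

  Σ-allVecs-by-red-green : ∀ n (F : ℕ → ℕ → A) →
    ∑[ v ∈ allVecs n ] F (reds v) (greens v) * t ^ whites v ≈ ∑[ k < suc n ] ∑[ l < suc n ] F k l * redGreenPoly n k l
  Σ-allVecs-by-red-green n F = begin
      ∑[ v ∈ allVecs n ] F (reds v) (greens v) * t ^ whites v
    ≈⟨ Σ-fibres (allVecs n) reds (λ k v → F k (greens v) * t ^ whites v) (λ v → s≤s (count≤length red v)) ⟩
      ∑[ k < suc n ] ∑[ v ∈ allVecs n ] δ k (reds v) * (F k (greens v) * t ^ whites v)
    ≈⟨ Σ-cong (upTo (suc n)) (λ k → Σ-fibres (allVecs n) greens (λ l v → δ k (reds v) * (F k l * t ^ whites v))
                                              (λ v → s≤s (count≤length green v))) ⟩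
      ∑[ k < suc n ] ∑[ l < suc n ] ∑[ v ∈ allVecs n ] δ l (greens v) * (δ k (reds v) * (F k l * t ^ whites v))
    ≈⟨ Σ-cong (upTo (suc n)) (λ k → Σ-cong (upTo (suc n)) (λ l → trans
         (Σ-cong (allVecs n) (λ v → solve 4 (λ x y z w → x :* (y :* (z :* w)) := z :* (y :* (x :* w))) refl
                                             (δ l (greens v)) (δ k (reds v)) (F k l) (t ^ whites v)))
         (sym (Σ-*ˡ (allVecs n) (F k l) _)))) ⟩
      ∑[ k < suc n ] ∑[ l < suc n ] F k l * redGreenPoly n k l
    ∎

  Σ-allVecs-by-profile : ∀ n (F : ℕ → ℕ → ℕ → A) →
    ∑[ v ∈ allVecs n ] F (reds v) (greens v) (greens v ℕ.+ whites v) ≈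
    ∑[ i < suc n ] ∑[ k < suc n ] ∑[ l < suc n ] F k l i * profileCount n k l i
  Σ-allVecs-by-profile n F = begin
      ∑[ v ∈ allVecs n ] F (reds v) (greens v) (greens v ℕ.+ whites v)
    ≈⟨ Σ-fibres (allVecs n) (λ v → greens v ℕ.+ whites v) (λ i v → F (reds v) (greens v) i) (λ v → s≤s (greens+whites≤length v)) ⟩
      ∑[ i < suc n ] ∑[ v ∈ allVecs n ] δ i (greens v ℕ.+ whites v) * F (reds v) (greens v) i
    ≈⟨ Σ-cong (upTo (suc n)) (λ i → Σ-fibres (allVecs n) reds (λ k v → δ i (greens v ℕ.+ whites v) * F k (greens v) i)
                                              (λ v → s≤s (count≤length red v))) ⟩
      ∑[ i < suc n ] ∑[ k < suc n ] ∑[ v ∈ allVecs n ] δ k (reds v) * (δ i (greens v ℕ.+ whites v) * F k (greens v) i)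
    ≈⟨ Σ-cong (upTo (suc n)) (λ i → Σ-cong (upTo (suc n)) (λ k →
         Σ-fibres (allVecs n) greens (λ l v → δ k (reds v) * (δ i (greens v ℕ.+ whites v) * F k l i))
                  (λ v → s≤s (count≤length green v)))) ⟩
      ∑[ i < suc n ] ∑[ k < suc n ] ∑[ l < suc n ] ∑[ v ∈ allVecs n ]
        δ l (greens v) * (δ k (reds v) * (δ i (greens v ℕ.+ whites v) * F k l i))
    ≈⟨ Σ-cong (upTo (suc n)) (λ i → Σ-cong (upTo (suc n)) (λ k → Σ-cong (upTo (suc n)) (λ l → trans
         (Σ-cong (allVecs n) (λ v → solve 4 (λ x y z w → x :* (y :* (z :* w)) := w :* (y :* (x :* z))) refl
                                             (δ l (greens v)) (δ k (reds v)) (δ i (greens v ℕ.+ whites v)) (F k l i)))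
         (sym (Σ-*ˡ (allVecs n) (F k l i) _))))) ⟩
      ∑[ i < suc n ] ∑[ k < suc n ] ∑[ l < suc n ] F k l i * profileCount n k l i
    ∎

  greenWhitePoly : ℕ → ℕ → ℕ → A
  greenWhitePoly n r g = ∑[ v ∈ allVecs n ] δ r (reds v) * (δ g (greens v) * t ^ (greens v ℕ.+ whites v))

  greenWhitePoly≈ : ∀ n r g → greenWhitePoly n r g ≈ ∑[ j < suc n ] t ^ j * profileCount n r g j
  greenWhitePoly≈ n r g = begin
      greenWhitePoly n r g
    ≈⟨ Σ-fibres (allVecs n) (λ v → greens v ℕ.+ whites v) (λ j v → δ r (reds v) * (δ g (greens v) * t ^ j))
                (λ v → s≤s (greens+whites≤length v)) ⟩
      ∑[ j < suc n ] ∑[ v ∈ allVecs n ] δ j (greens v ℕ.+ whites v) * (δ r (reds v) * (δ g (greens v) * t ^ j))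
    ≈⟨ Σ-cong (upTo (suc n)) (λ j → trans
         (Σ-cong (allVecs n) (λ v → solve 4 (λ x y z p → x :* (y :* (z :* p)) := p :* (y :* (z :* x))) refl
                                             (δ j (greens v ℕ.+ whites v)) (δ r (reds v)) (δ g (greens v)) (t ^ j)))
         (sym (Σ-*ˡ (allVecs n) (t ^ j) _))) ⟩
      ∑[ j < suc n ] t ^ j * profileCount n r g j
    ∎

  module _ (a b : ℕ) where

    goodSum : A
    goodSum = ∑[ col ∈ goodColorings a b ] t ^ (gC col ℕ.+ wC col)

    goodSum≈Σ-redGreenPoly :
      goodSum ≈ ∑[ k < suc a ] ∑[ l < suc a ] t ^ (l ℕ.+ k) * redGreenPoly b l k * redGreenPoly a k l
    goodSum≈Σ-redGreenPoly = begin
        goodSum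
      ≈⟨ Σ-goodColorings a b _ ⟩
        ∑[ u ∈ allVecs a ] ∑[ v ∈ allVecs b ]
          δ (reds u) (greens v) * (δ (greens u) (reds v) * t ^ ((greens u ℕ.+ greens v) ℕ.+ (whites u ℕ.+ whites v)))
      ≈⟨ Σ-cong (allVecs a) (λ u → Σ-over-B (reds u) (greens u) (whites u)) ⟩
        ∑[ u ∈ allVecs a ] t ^ (greens u ℕ.+ reds u) * redGreenPoly b (greens u) (reds u) * t ^ whites u
      ≈⟨ Σ-allVecs-by-red-green a (λ k l → t ^ (l ℕ.+ k) * redGreenPoly b l k) ⟩
        ∑[ k < suc a ] ∑[ l < suc a ] t ^ (l ℕ.+ k) * redGreenPoly b l k * redGreenPoly a k l
      ∎
      where
      Σ-over-B : ∀ k l w → ∑[ v ∈ allVecs b ] δ k (greens v) * (δ l (reds v) * t ^ ((l ℕ.+ greens v) ℕ.+ (w ℕ.+ whites v)))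
                           ≈ t ^ (l ℕ.+ k) * redGreenPoly b l k * t ^ w
      Σ-over-B k l w = begin
          ∑[ v ∈ allVecs b ] δ k (greens v) * (δ l (reds v) * t ^ ((l ℕ.+ greens v) ℕ.+ (w ℕ.+ whites v)))
        ≈⟨ Σ-cong (allVecs b) (λ v → δ-subst k (greens v) (λ z → δ l (reds v) * t ^ ((l ℕ.+ z) ℕ.+ (w ℕ.+ whites v)))) ⟩
          ∑[ v ∈ allVecs b ] δ k (greens v) * (δ l (reds v) * t ^ ((l ℕ.+ k) ℕ.+ (w ℕ.+ whites v)))
        ≈⟨ Σ-cong (allVecs b) (λ v → trans (*-congˡ (*-congˡ (trans (^-homo-* t (l ℕ.+ k) _) (*-congˡ (^-homo-* t w _)))))
             (solve 5 (λ x y p q r → x :* (y :* (p :* (q :* r))) := p :* q :* (y :* (x :* r))) refl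
                      (δ k (greens v)) (δ l (reds v)) (t ^ (l ℕ.+ k)) (t ^ w) (t ^ whites v))) ⟩
          ∑[ v ∈ allVecs b ] t ^ (l ℕ.+ k) * t ^ w * (δ l (reds v) * (δ k (greens v) * t ^ whites v))
        ≈⟨ sym (Σ-*ˡ (allVecs b) _ _) ⟩
          t ^ (l ℕ.+ k) * t ^ w * redGreenPoly b l k
        ≈⟨ solve 3 (λ p q y → p :* q :* y := p :* y :* q) refl (t ^ (l ℕ.+ k)) (t ^ w) _ ⟩
          t ^ (l ℕ.+ k) * redGreenPoly b l k * t ^ w
        ∎

    middleTerm : ℕ → A
    middleTerm i = ⟦ ((i ℕ.+ i) C i) ℕ.* (a C i) ℕ.* (b C i) ⟧ * t ^ i * 1+t ^ (a ℕ.+ b ℕ.+ 1 ∸ (i ℕ.+ i))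

    middleTerm-vanishes : ∀ i → a < i ⊎ b < i → middleTerm i ≈ 0#
    middleTerm-vanishes i a<i⊎b<i =
      trans (*-congʳ (*-congʳ (reflexive (≡.cong ⟦_⟧ (coefficient≡0 a<i⊎b<i))))) (trans (*-congʳ (zeroˡ _)) (zeroˡ _))
      where
      coefficient≡0 : a < i ⊎ b < i → ((i ℕ.+ i) C i) ℕ.* (a C i) ℕ.* (b C i) ≡ 0
      coefficient≡0 (inj₁ a<i) rewrite k>n⇒nCk≡0 a<i | ℕ.*-zeroʳ ((i ℕ.+ i) C i) = ≡.refl
      coefficient≡0 (inj₂ b<i) rewrite k>n⇒nCk≡0 b<i = ℕ.*-zeroʳ (((i ℕ.+ i) C i) ℕ.* (a C i))

    antidiagonalTerm : ℕ → ℕ → A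
    antidiagonalTerm k l = 1+t * (t ^ (l ℕ.+ k) * redGreenClosed b (l ℕ.+ k) l * redGreenClosed a (k ℕ.+ l) k)

    Σ-antidiagonal : ∀ {i} → i ≤ a → ∑[ k < suc i ] antidiagonalTerm k (i ∸ k) ≈ middleTerm i
    Σ-antidiagonal {i} i≤a = begin
        ∑[ k < suc i ] antidiagonalTerm k (i ∸ k)
      ≈⟨ ∑<-cong (suc i) (λ k k<1+i → term (ℕ.≤-pred k<1+i)) ⟩
        ∑[ k < suc i ] common * (⟦ i C k ⟧ * ⟦ i C k ⟧)
      ≈⟨ sym (Σ-*ˡ (upTo (suc i)) common _) ⟩
        common * (∑[ k < suc i ] ⟦ i C k ⟧ * ⟦ i C k ⟧)
      ≈⟨ *-congˡ (vandermonde i i 0 ℕ.≤-refl) ⟩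
        common * ⟦ (i ℕ.+ i) C i ⟧
      ≈⟨ collect (i ℕ.≤? b) ⟩
        middleTerm i
      ∎
      where
      common : A
      common = ⟦ a C i ⟧ * ⟦ b C i ⟧ * t ^ i * (1+t * (1+t ^ (b ∸ i) * 1+t ^ (a ∸ i)))
      term : ∀ {k} → k ≤ i → antidiagonalTerm k (i ∸ k) ≈ common * (⟦ i C k ⟧ * ⟦ i C k ⟧)
      term {k} k≤i = begin
          antidiagonalTerm k (i ∸ k)
        ≡⟨ ≡.cong₂ (λ p q → 1+t * (t ^ p * redGreenClosed b p (i ∸ k) * redGreenClosed a q k))
                   (ℕ.m∸n+n≡m k≤i) (ℕ.m+[n∸m]≡n k≤i) ⟩
          1+t * (t ^ i * (⟦ b C i ⟧ * ⟦ i C (i ∸ k) ⟧ * 1+t ^ (b ∸ i)) * redGreenClosed a i k)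
        ≡⟨ ≡.cong (λ z → 1+t * (t ^ i * (⟦ b C i ⟧ * ⟦ z ⟧ * 1+t ^ (b ∸ i)) * redGreenClosed a i k))
                  (≡.sym (nCk≡nC[n∸k] k≤i)) ⟩
          1+t * (t ^ i * (⟦ b C i ⟧ * ⟦ i C k ⟧ * 1+t ^ (b ∸ i)) * (⟦ a C i ⟧ * ⟦ i C k ⟧ * 1+t ^ (a ∸ i)))
        ≈⟨ solve 7 (λ p x y z w q r → p :* (x :* (y :* z :* w) :* (q :* z :* r)) := q :* y :* x :* (p :* (w :* r)) :* (z :* z))
                 refl 1+t (t ^ i) ⟦ b C i ⟧ ⟦ i C k ⟧ (1+t ^ (b ∸ i)) ⟦ a C i ⟧ (1+t ^ (a ∸ i)) ⟩
          common * (⟦ i C k ⟧ * ⟦ i C k ⟧)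
        ∎
      collect : Dec (i ≤ b) → common * ⟦ (i ℕ.+ i) C i ⟧ ≈ middleTerm i
      collect (yes i≤b) = begin
          ⟦ a C i ⟧ * ⟦ b C i ⟧ * t ^ i * (1+t * (1+t ^ (b ∸ i) * 1+t ^ (a ∸ i))) * ⟦ (i ℕ.+ i) C i ⟧
        ≈⟨ *-congʳ (*-congˡ (*-congˡ (sym (^-homo-* 1+t (b ∸ i) (a ∸ i))))) ⟩
          ⟦ a C i ⟧ * ⟦ b C i ⟧ * t ^ i * 1+t ^ suc ((b ∸ i) ℕ.+ (a ∸ i)) * ⟦ (i ℕ.+ i) C i ⟧
        ≡⟨ ≡.cong (λ e → ⟦ a C i ⟧ * ⟦ b C i ⟧ * t ^ i * 1+t ^ e * ⟦ (i ℕ.+ i) C i ⟧) (1+[b∸i]+[a∸i]≡a+b+1∸[i+i] i≤a i≤b) ⟩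
          ⟦ a C i ⟧ * ⟦ b C i ⟧ * t ^ i * Q * ⟦ (i ℕ.+ i) C i ⟧
        ≈⟨ solve 5 (λ x y p q z → x :* y :* p :* q :* z := z :* x :* y :* p :* q) refl _ _ _ _ _ ⟩
          ⟦ (i ℕ.+ i) C i ⟧ * ⟦ a C i ⟧ * ⟦ b C i ⟧ * t ^ i * Q
        ≈⟨ *-congʳ (*-congʳ (sym (trans (⟦*⟧ (((i ℕ.+ i) C i) ℕ.* (a C i)) (b C i)) (*-congʳ (⟦*⟧ ((i ℕ.+ i) C i) (a C i)))))) ⟩
          middleTerm i
        ∎
        where
        Q : A
        Q = 1+t ^ (a ℕ.+ b ℕ.+ 1 ∸ (i ℕ.+ i))
      collect (no i≰b) = trans common*≈0 (sym (middleTerm-vanishes i (inj₂ (ℕ.≰⇒> i≰b))))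
        where
        common*≈0 : common * ⟦ (i ℕ.+ i) C i ⟧ ≈ 0#
        common*≈0 rewrite k>n⇒nCk≡0 (ℕ.≰⇒> i≰b) =
          trans (*-congʳ (trans (*-congʳ (trans (*-congʳ (zeroʳ _)) (zeroˡ _))) (zeroˡ _))) (zeroˡ _)

    antidiagonalTerm-vanishes : ∀ k l → a < k ℕ.+ l → antidiagonalTerm k l ≈ 0#
    antidiagonalTerm-vanishes k l a<k+l rewrite k>n⇒nCk≡0 a<k+l =
      trans (*-congˡ (trans (*-congˡ (trans (*-congʳ (zeroˡ _)) (zeroˡ _))) (zeroʳ _))) (zeroʳ 1+t)

    lhs≈middle : lhs R a b t ≈ middle R a b t
    lhs≈middle = begin
        1+t * goodSum
      ≈⟨ *-congˡ goodSum≈Σ-redGreenPoly ⟩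
        1+t * (∑[ k < suc a ] ∑[ l < suc a ] t ^ (l ℕ.+ k) * redGreenPoly b l k * redGreenPoly a k l)
      ≈⟨ trans (Σ-*ˡ (upTo (suc a)) 1+t _) (Σ-cong (upTo (suc a)) (λ k → trans (Σ-*ˡ (upTo (suc a)) 1+t _)
           (Σ-cong (upTo (suc a)) (λ l →
             *-congˡ (*-cong (*-congˡ (redGreenPoly≈ b l k ≡.refl)) (redGreenPoly≈ a k l ≡.refl)))))) ⟩
        ∑[ k < suc a ] ∑[ l < suc a ] antidiagonalTerm k l
      ≈⟨ Σ-cong (upTo (suc a)) (λ k → ∑<-truncate (ℕ.m∸n≤m (suc a) k) (λ l 1+a∸k≤l →
           antidiagonalTerm-vanishes k l (ℕ.≤-trans (ℕ.m≤n+m∸n (suc a) k) (ℕ.+-monoʳ-≤ k 1+a∸k≤l)))) ⟩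
        ∑[ k < suc a ] ∑[ l < suc a ∸ k ] antidiagonalTerm k l
      ≈⟨ ∑<-triangle (suc a) antidiagonalTerm ⟩
        ∑[ i < suc a ] ∑[ k < suc i ] antidiagonalTerm k (i ∸ k)
      ≈⟨ ∑<-cong (suc a) (λ i i<1+a → Σ-antidiagonal (ℕ.≤-pred i<1+a)) ⟩
        ∑[ i < suc a ] middleTerm i
      ≈⟨ ∑<-truncate (s≤s (ℕ.m⊓n≤m a b)) (λ i a⊓b<i → middleTerm-vanishes i (m⊓n<o⇒m<o⊎n<o a⊓b<i)) ⟩
        ∑[ i < suc (a ⊓ b) ] middleTerm i
      ∎

    profileTerm : ℕ → ℕ → ℕ → ℕ → A
    profileTerm i j k l = t ^ i * t ^ j * (trinomial b l k j * trinomial a k l i)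

    coefficient : ℕ → ℕ → ℕ
    coefficient i j = (a C i) ℕ.* (b C j) ℕ.* ((a ∸ i ℕ.+ j) C j) ℕ.* ((b ℕ.+ i ∸ j) C i)

    goodSum≈Σ-profileTerm :
      goodSum ≈ ∑[ i < suc a ] ∑[ j < suc b ] ∑[ k < suc a ] ∑[ l < suc a ] profileTerm i j k l
    goodSum≈Σ-profileTerm = begin
        goodSum
      ≈⟨ Σ-goodColorings a b _ ⟩
        ∑[ u ∈ allVecs a ] ∑[ v ∈ allVecs b ]
          δ (reds u) (greens v) * (δ (greens u) (reds v) * t ^ ((greens u ℕ.+ greens v) ℕ.+ (whites u ℕ.+ whites v)))
      ≈⟨ Σ-cong (allVecs a) (λ u → Σ-over-B (reds u) (greens u) (whites u)) ⟩
        ∑[ u ∈ allVecs a ] t ^ (greens u ℕ.+ whites u) * greenWhitePoly b (greens u) (reds u)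
      ≈⟨ Σ-allVecs-by-profile a (λ k l i → t ^ i * greenWhitePoly b l k) ⟩
        ∑[ i < suc a ] ∑[ k < suc a ] ∑[ l < suc a ] t ^ i * greenWhitePoly b l k * profileCount a k l i
      ≈⟨ Σ-cong (upTo (suc a)) (λ i → Σ-cong (upTo (suc a)) (λ k → Σ-cong (upTo (suc a)) (λ l → expand i k l))) ⟩
        ∑[ i < suc a ] ∑[ k < suc a ] ∑[ l < suc a ] ∑[ j < suc b ] profileTerm i j k l
      ≈⟨ Σ-cong (upTo (suc a)) (λ i → trans
           (Σ-cong (upTo (suc a)) (λ k → Σ-swap (upTo (suc a)) (upTo (suc b)) (λ l j → profileTerm i j k l)))
           (Σ-swap (upTo (suc a)) (upTo (suc b)) (λ k j → ∑[ l < suc a ] profileTerm i j k l))) ⟩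
        ∑[ i < suc a ] ∑[ j < suc b ] ∑[ k < suc a ] ∑[ l < suc a ] profileTerm i j k l
      ∎
      where
      Σ-over-B : ∀ k l w → ∑[ v ∈ allVecs b ] δ k (greens v) * (δ l (reds v) * t ^ ((l ℕ.+ greens v) ℕ.+ (w ℕ.+ whites v)))
                           ≈ t ^ (l ℕ.+ w) * greenWhitePoly b l k
      Σ-over-B k l w = begin
          ∑[ v ∈ allVecs b ] δ k (greens v) * (δ l (reds v) * t ^ ((l ℕ.+ greens v) ℕ.+ (w ℕ.+ whites v)))
        ≈⟨ Σ-cong (allVecs b) (λ v → trans
             (*-congˡ (*-congˡ (trans (reflexive (≡.cong (t ^_) (+-interchange l (greens v) w (whites v))))
                                      (^-homo-* t (l ℕ.+ w) _))))
             (solve 4 (λ x y p q → x :* (y :* (p :* q)) := p :* (y :* (x :* q))) refl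
                      (δ k (greens v)) (δ l (reds v)) (t ^ (l ℕ.+ w)) (t ^ (greens v ℕ.+ whites v)))) ⟩
          ∑[ v ∈ allVecs b ] t ^ (l ℕ.+ w) * (δ l (reds v) * (δ k (greens v) * t ^ (greens v ℕ.+ whites v)))
        ≈⟨ sym (Σ-*ˡ (allVecs b) _ _) ⟩
          t ^ (l ℕ.+ w) * greenWhitePoly b l k
        ∎
      expand : ∀ i k l → t ^ i * greenWhitePoly b l k * profileCount a k l i ≈ ∑[ j < suc b ] profileTerm i j k l
      expand i k l = begin
          t ^ i * greenWhitePoly b l k * profileCount a k l i
        ≈⟨ *-cong (*-congˡ (trans (greenWhitePoly≈ b l k) (Σ-cong (upTo (suc b)) (λ j → *-congˡ (profileCount≈ b l k j)))))
                  (profileCount≈ a k l i) ⟩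
          t ^ i * (∑[ j < suc b ] t ^ j * trinomial b l k j) * trinomial a k l i
        ≈⟨ trans (*-congʳ (Σ-*ˡ (upTo (suc b)) _ _)) (Σ-*ʳ (upTo (suc b)) _ _) ⟩
          ∑[ j < suc b ] t ^ i * (t ^ j * trinomial b l k j) * trinomial a k l i
        ≈⟨ Σ-cong (upTo (suc b)) (λ j → solve 4 (λ p q y z → p :* (q :* y) :* z := p :* q :* (y :* z)) refl
                                                 (t ^ i) (t ^ j) (trinomial b l k j) (trinomial a k l i)) ⟩
          ∑[ j < suc b ] profileTerm i j k l
        ∎

    Σ-profileTerm : ∀ {i j} → i ≤ a → j ≤ b →
      ∑[ k < suc a ] ∑[ l < suc a ] profileTerm i j k l ≈ ⟦ coefficient i j ⟧ * t ^ (i ℕ.+ j)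
    Σ-profileTerm {i} {j} i≤a j≤b = begin
        ∑[ k < suc a ] ∑[ l < suc a ] profileTerm i j k l
      ≈⟨ Σ-cong (upTo (suc a)) (λ k → trans (Σ-cong (upTo (suc a)) (λ l → regroup k l)) (sym (Σ-*ˡ (upTo (suc a)) scale _))) ⟩
        ∑[ k < suc a ] scale * (∑[ l < suc a ] (⟦ j C k ⟧ * ⟦ (a ∸ i) C k ⟧) * (⟦ (b ∸ j) C l ⟧ * ⟦ i C l ⟧))
      ≈⟨ trans (sym (Σ-*ˡ (upTo (suc a)) scale _)) (*-congˡ (Σ-*-Σ (upTo (suc a)) (upTo (suc a)) _ _)) ⟩
        scale * ((∑[ k < suc a ] ⟦ j C k ⟧ * ⟦ (a ∸ i) C k ⟧) * (∑[ l < suc a ] ⟦ (b ∸ j) C l ⟧ * ⟦ i C l ⟧))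
      ≈⟨ *-congˡ (*-cong (vandermonde j (a ∸ i) 0 (s≤s (ℕ.m∸n≤m a i))) (vandermonde (b ∸ j) i 0 (s≤s i≤a))) ⟩
        scale * (⟦ (j ℕ.+ (a ∸ i)) C (a ∸ i) ⟧ * ⟦ (b ∸ j ℕ.+ i) C i ⟧)
      ≡⟨ ≡.cong₂ (λ x y → scale * (⟦ x ⟧ * ⟦ y C i ⟧)) ([m+n]Cn≡[n+m]Cm j (a ∸ i)) (≡.sym (ℕ.+-∸-comm i j≤b)) ⟩
        scale * (⟦ (a ∸ i ℕ.+ j) C j ⟧ * ⟦ (b ℕ.+ i ∸ j) C i ⟧)
      ≈⟨ solve 6 (λ p q x y z w → p :* q :* x :* y :* (z :* w) := x :* y :* z :* w :* (p :* q)) refl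
               (t ^ i) (t ^ j) ⟦ a C i ⟧ ⟦ b C j ⟧ _ _ ⟩
        ⟦ a C i ⟧ * ⟦ b C j ⟧ * ⟦ (a ∸ i ℕ.+ j) C j ⟧ * ⟦ (b ℕ.+ i ∸ j) C i ⟧ * (t ^ i * t ^ j)
      ≈⟨ *-cong ⟦coefficient⟧ (sym (^-homo-* t i j)) ⟩
        ⟦ coefficient i j ⟧ * t ^ (i ℕ.+ j)
      ∎
      where
      scale : A
      scale = t ^ i * t ^ j * ⟦ a C i ⟧ * ⟦ b C j ⟧
      regroup : ∀ k l → profileTerm i j k l ≈ scale * ((⟦ j C k ⟧ * ⟦ (a ∸ i) C k ⟧) * (⟦ (b ∸ j) C l ⟧ * ⟦ i C l ⟧))
      regroup k l =
        solve 8 (λ p q x y u v w z → p :* q :* (y :* u :* w :* (x :* z :* v)) := p :* q :* x :* y :* ((u :* v) :* (w :* z)))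
        refl (t ^ i) (t ^ j) ⟦ a C i ⟧ ⟦ b C j ⟧ ⟦ j C k ⟧ ⟦ (a ∸ i) C k ⟧ ⟦ (b ∸ j) C l ⟧ ⟦ i C l ⟧
      ⟦coefficient⟧ : ⟦ a C i ⟧ * ⟦ b C j ⟧ * ⟦ (a ∸ i ℕ.+ j) C j ⟧ * ⟦ (b ℕ.+ i ∸ j) C i ⟧ ≈ ⟦ coefficient i j ⟧
      ⟦coefficient⟧ = sym (trans (⟦*⟧ (x ℕ.* y ℕ.* z) w) (*-congʳ (trans (⟦*⟧ (x ℕ.* y) z) (*-congʳ (⟦*⟧ x y)))))
        where
        x y z w : ℕ
        x = a C i
        y = b C j
        z = (a ∸ i ℕ.+ j) C j
        w = (b ℕ.+ i ∸ j) C i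

    lhs≈rhs : lhs R a b t ≈ rhs R a b t
    lhs≈rhs = *-congˡ (trans goodSum≈Σ-profileTerm
      (∑<-cong (suc a) (λ i i<1+a → ∑<-cong (suc b) (λ j j<1+b → Σ-profileTerm (ℕ.≤-pred i<1+a) (ℕ.≤-pred j<1+b)))))

proposition4p2 : {c ℓ : Level} (R : CommutativeSemiring c ℓ) (a b : ℕ) (t : CommutativeSemiring.Carrier R) →
    CommutativeSemiring._≈_ R (lhs R a b t) (middle R a b t)
    × CommutativeSemiring._≈_ R (middle R a b t) (rhs R a b t)
proposition4p2 R a b t = lhs≈middle a b , trans (sym (lhs≈middle a b)) (lhs≈rhs a b)
  where
  open CommutativeSemiring R using (sym; trans)
  open Colorings R t using (lhs≈middle; lhs≈rhs)
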